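{- For the binary alphabet $\{0,1\}$, any algorithm that exactly recovers an arbitrary input sequence $s\in\{0,1\}^{\ell}$, $0\le\ell\le n$, by querying the DTW distance from $s$ to a set of query sequences of length $\mathcal{O}(n)$ over a constant-sized extended alphabet $\Sigma\supseteq\{0,1\}$ of real numbers, has query complexity $\Omega(n/\log n)$.
   Context: An expansion of a sequence $x$ is any sequence obtained from $x$ by replacing each character by one or more consecutive copies of itself. For sequences $x,y$ of real numbers, $d_{\mathrm{DTW}}(x,y)=\min\|\bar x-\bar y\|_1$ over all pairs $(\bar x,\bar y)$ of equal-length expansions of $x$ and $y$. The length of $s$ is unknown. -}

module Defs where

open import Level using (Level; _⊔_)
open import Data.Nat as ℕ using (ℕ; zero; suc)
open import Data.List using (List; []; _∷_; length; replicate; _++_)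
open import Data.List.Membership.Propositional using (_∈_)
open import Data.List.Relation.Unary.All using (All)
open import Data.Vec using (Vec; []; _∷_)
open import Data.Maybe using (Maybe; just; nothing)
open import Data.Product using (Σ; ∃; _×_; _,_)
open import Data.Sum using (_⊎_)
open import Data.Empty using (⊥)
open import Relation.Nullary using (¬_)
open import Relation.Binary.PropositionalEquality using (_≡_)

-- The paper works with sequences of REAL numbers.  agda-stdlib has no
-- reals, so we work over an arbitrary linearly ordered abelian group
-- (with a distinguished positive element 1), of which (ℝ,+,≤,1) is an
-- instance.  Only +, -, ≤ (hence |·|) are used by DTW.

record OrderedGroup (c ℓ : Level) : Set (Level.suc (c ⊔ ℓ)) where
  infixl 6 _+_
  infix  4 _≤_
  field
    Carrier : Set c
    _+_     : Carrier → Carrier → Carrier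
    0#      : Carrier
    -_      : Carrier → Carrier
    1#      : Carrier
    _≤_     : Carrier → Carrier → Set ℓ
    +-assoc     : ∀ x y z → (x + y) + z ≡ x + (y + z)
    +-comm      : ∀ x y → x + y ≡ y + x
    +-identityˡ : ∀ x → 0# + x ≡ x
    -‿inverseˡ  : ∀ x → (- x) + x ≡ 0#
    ≤-refl      : ∀ {x} → x ≤ x
    ≤-trans     : ∀ {x y z} → x ≤ y → y ≤ z → x ≤ z
    ≤-antisym   : ∀ {x y} → x ≤ y → y ≤ x → x ≡ y
    ≤-total     : ∀ x y → (x ≤ y) ⊎ (y ≤ x)
    +-monoˡ-≤   : ∀ {x y} z → x ≤ y → x + z ≤ y + z
    0≤1         : 0# ≤ 1#
    0≢1         : ¬ (0# ≡ 1#)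

module DTW {c ℓ} (G : OrderedGroup c ℓ) where
  open OrderedGroup G public

  data Abs (x : Carrier) : Carrier → Set (c ⊔ ℓ) where
    abs-pos : 0# ≤ x → Abs x x
    abs-neg : x ≤ 0# → Abs x (- x)

  Bit : Carrier → Set c
  Bit a = (a ≡ 0#) ⊎ (a ≡ 1#)

  expand : (x : List Carrier) → Vec ℕ (length x) → List Carrier
  expand []       []       = []
  expand (a ∷ x)  (r ∷ rs) = replicate (suc r) a ++ expand x rs

  Expansion : List Carrier → List Carrier → Set c
  Expansion x y = Σ (Vec ℕ (length x)) λ r → expand x r ≡ y

  data L1 : List Carrier → List Carrier → Carrier → Set (c ⊔ ℓ) where
    l1-[] : L1 [] [] 0#
    l1-∷  : ∀ {a b x y d e} → Abs (a + (- b)) e → L1 x y d →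
            L1 (a ∷ x) (b ∷ y) (e + d)

  Admissible : List Carrier → List Carrier → Carrier → Set (c ⊔ ℓ)
  Admissible x y d =
    ∃ λ x̄ → ∃ λ ȳ → Expansion x x̄ × Expansion y ȳ ×
      length x̄ ≡ length ȳ × L1 x̄ ȳ d

  IsDTW : List Carrier → List Carrier → Carrier → Set (c ⊔ ℓ)
  IsDTW x y d =
    Admissible x y d × (∀ d' → Admissible x y d' → d ≤ d')

  -- The oracle answer to a query: just d if d_DTW(s,q) = d, and nothing
  -- (i.e. "∞") if there is no pair of equal-length expansions at all
  -- (only possible when exactly one of s, q is empty).
  Answer : List Carrier → List Carrier → Maybe Carrier → Set (c ⊔ ℓ)
  Answer s q (just d) = IsDTW s q d
  Answer s q nothing  = ¬ (∃ λ d → Admissible s q d)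

  -- An (adaptive, deterministic) query algorithm: a decision tree that
  -- either outputs a sequence or asks a query sequence and continues
  -- depending on the answer.
  data Algorithm : Set c where
    output : List Carrier → Algorithm
    ask    : List Carrier → (Maybe Carrier → Algorithm) → Algorithm

  Recovers : List Carrier → ℕ → Algorithm → List Carrier → ℕ → Set (c ⊔ ℓ)
  Recovers Σ' L (output o)  s k       = Lift′ (o ≡ s)
    where
      Lift′ : Set c → Set (c ⊔ ℓ)
      Lift′ A = Level.Lift (c ⊔ ℓ) A
  Recovers Σ' L (ask q f)   s zero    = Level.Lift (c ⊔ ℓ) ⊥
  Recovers Σ' L (ask q f)   s (suc k) =
    All (_∈ Σ') q × Level.Lift (c ⊔ ℓ) (length q ℕ.≤ L) ×
    (∀ a → Answer s q a → Recovers Σ' L (f a) s k)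

module Submission where

-- A warping path of s and q visits fewer than |s| + |q| cells and pays
-- |a - σ| at each of them, with a ∈ {0,1} and σ ∈ Σ.  Hence d_DTW(s, q),
-- the cost of a cheapest path (computed by the usual dynamic-programming
-- recursion), is a sum Σᵢ kᵢ tᵢ over the t ≤ 2|Σ| such terms tᵢ with every
-- kᵢ ≤ n + Cn, so each answer takes one of at most 1 + (n + Cn + 1)^t
-- values (one for ∞).  After k queries a deterministic algorithm can thus
-- tell apart at most (1 + (n + Cn + 1)^t)^k inputs, while recovering all
-- 2^n binary strings of length n forces 2^n ≤ (1 + (n + Cn + 1)^t)^k,
-- that is n = O(t k log n).

open import Defs
open import Level using (_⊔_; lift)
open import Data.Nat as ℕ using (ℕ; zero; suc; z≤n; s≤s)
import Data.Nat.Properties as ℕ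
open import Data.List as List using (List; []; _∷_; length; replicate; _++_; cartesianProductWith)
open import Data.List.Membership.Propositional using (_∈_)
open import Data.List.Membership.Propositional.Properties using (∈-cartesianProductWith⁺)
import Data.List.Properties as List
open import Data.List.Relation.Unary.Any using (here; there)
open import Data.List.Relation.Unary.All as All using (All; []; _∷_)
open import Data.List.Relation.Unary.All.Properties using (map⁺)
open import Data.Vec as Vec using (Vec; []; _∷_)
import Data.Vec.Properties as Vec
import Data.Vec.Relation.Unary.All as VecAll
open import Data.Vec.Recursive.Properties using (↔Vec)
open import Data.Vec.Recursive using (Fin[m^n]↔Fin[m]^n)
open import Data.Vec.Relation.Binary.Equality.Cast using (cast-is-id)
open import Data.Fin as Fin using (Fin; zero; suc; toℕ; fromℕ<)
import Data.Fin.Properties as Fin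
open import Data.Maybe using (Maybe; just; nothing)
open import Data.Product using (∃; ∃₂; _×_; _,_)
open import Data.Sum using (_⊎_; inj₁; inj₂; [_,_])
open import Data.Empty using (⊥-elim)
open import Function using (_∘_; _↔_; _↣_; Injective; Inverse; Injection; mk↣)
open import Function.Properties.Inverse using (↔-sym; ↔-trans; ↔⇒↣)
open import Function.Properties.Injection using (↣-trans)
open import Relation.Nullary using (¬_)
open import Relation.Binary.PropositionalEquality
  using (_≡_; refl; sym; trans; cong; cong₂; subst; subst₂; module ≡-Reasoning)

module Arithmetic where
  open import Data.Nat
  open import Data.Nat.Properties
  open import Data.Nat.Logarithm
  open import Data.Nat.Solver using (module +-*-Solver)
  open import Relation.Binary.PropositionalEquality

  2^m≤2^n⇒m≤n : ∀ {m n} → 2 ^ m ≤ 2 ^ n → m ≤ n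
  2^m≤2^n⇒m≤n le = ≮⇒≥ λ n<m → <⇒≱ (^-monoʳ-< 2 (s≤s (s≤s z≤n)) n<m) le

  n<2^[1+⌊log₂n⌋] : ∀ n → n < 2 ^ suc ⌊log₂ n ⌋
  n<2^[1+⌊log₂n⌋] n = ≰⇒> λ le →
    1+n≰n (subst (_≤ ⌊log₂ n ⌋) (⌊log₂[2^n]⌋≡n (suc ⌊log₂ n ⌋)) (⌊log₂⌋-mono-≤ le))

  2^n≤m^e⇒n≤p*e : ∀ {m p n} e → m ≤ 2 ^ p → 2 ^ n ≤ m ^ e → n ≤ p * e
  2^n≤m^e⇒n≤p*e {m} {p} e m≤2^p 2^n≤m^e = 2^m≤2^n⇒m≤n (begin
    _         ≤⟨ 2^n≤m^e ⟩
    m ^ e     ≤⟨ ^-monoˡ-≤ e m≤2^p ⟩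
    (2 ^ p) ^ e ≡⟨ ^-*-assoc 2 p e ⟩
    2 ^ (p * e) ∎)
    where open ≤-Reasoning

  1+[1+m]^n≤[2+m]^[1+n] : ∀ m n → suc (suc m ^ n) ≤ suc (suc m) ^ suc n
  1+[1+m]^n≤[2+m]^[1+n] m n = begin
    suc P                    ≤⟨ +-monoˡ-≤ P (m^n>0 (suc m) n) ⟩
    P + P                    ≡⟨ cong (P +_) (sym (+-identityʳ P)) ⟩
    2 * P                    ≤⟨ *-mono-≤ {2} {suc (suc m)} (s≤s (s≤s z≤n)) (^-monoˡ-≤ n (n≤1+n (suc m))) ⟩
    suc (suc m) ^ suc n      ∎
    where
      open ≤-Reasoning
      P = suc m ^ n

  2+n+C*n≤n*n : ∀ {n} C → 2 + C ≤ n → 2 + (n + C * n) ≤ n * n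
  2+n+C*n≤n*n {n} C 2+C≤n = ≤-trans
    (+-monoˡ-≤ (n + C * n) (≤-trans (s≤s (s≤s z≤n)) 2+C≤n))
    (*-monoˡ-≤ n 2+C≤n)

  exponential≤polynomial⇒n≤k*⌊log₂n⌋ : ∀ {n} C t k → 2 + C ≤ n →
    2 ^ n ≤ suc (suc (n + C * n) ^ t) ^ k → n ≤ 4 * suc t * k * ⌊log₂ n ⌋
  exponential≤polynomial⇒n≤k*⌊log₂n⌋ {n} C t k 2+C≤n 2^n≤M^k = begin
    n                       ≤⟨ 2^n≤m^e⇒n≤p*e {p = l′ + l′} (suc t * k) n*n≤2^p 2^n≤[n*n]^e ⟩
    (l′ + l′) * (suc t * k) ≤⟨ *-monoˡ-≤ (suc t * k) (+-mono-≤ l′≤l+l l′≤l+l) ⟩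
    ((l + l) + (l + l)) * (suc t * k)
      ≡⟨ solve 3 (λ l s k → ((l :+ l) :+ (l :+ l)) :* (s :* k) := con 4 :* s :* k :* l) refl l (suc t) k ⟩
    4 * suc t * k * l       ∎
    where
      open ≤-Reasoning
      open +-*-Solver
      l = ⌊log₂ n ⌋
      l′ = suc l
      l′≤l+l : l′ ≤ l + l
      l′≤l+l = +-monoˡ-≤ l (⌊log₂⌋-mono-≤ (≤-trans (s≤s (s≤s z≤n)) 2+C≤n))
      n*n≤2^p : n * n ≤ 2 ^ (l′ + l′)
      n*n≤2^p = ≤-trans (*-mono-≤ (<⇒≤ (n<2^[1+⌊log₂n⌋] n)) (<⇒≤ (n<2^[1+⌊log₂n⌋] n)))
                          (≤-reflexive (sym (^-distribˡ-+-* 2 l′ l′)))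
      2^n≤[n*n]^e : 2 ^ n ≤ (n * n) ^ (suc t * k)
      2^n≤[n*n]^e = ≤-trans 2^n≤M^k (≤-trans
        (^-monoˡ-≤ k (≤-trans (1+[1+m]^n≤[2+m]^[1+n] (n + C * n) t)
                                  (^-monoˡ-≤ (suc t) (2+n+C*n≤n*n C 2+C≤n))))
        (≤-reflexive (^-*-assoc (n * n) (suc t) k)))

Vec[Fin]↔Fin[^] : ∀ m k → Vec (Fin m) k ↔ Fin (m ℕ.^ k)
Vec[Fin]↔Fin[^] m k = ↔-sym (↔-trans (Fin[m^n]↔Fin[m]^n m k) (↔Vec k))

toFins : ∀ {j k} (ks : Vec ℕ k) → VecAll.All (ℕ._≤ j) ks → Vec (Fin (suc j)) k
toFins []       VecAll.[]            = []
toFins (k ∷ ks) (k≤j VecAll.∷ ks≤j) = fromℕ< (s≤s k≤j) ∷ toFins ks ks≤j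

map-toℕ-toFins : ∀ {j k} (ks : Vec ℕ k) (ks≤j : VecAll.All (ℕ._≤ j) ks) →
                 Vec.map toℕ (toFins ks ks≤j) ≡ ks
map-toℕ-toFins []       VecAll.[]            = refl
map-toℕ-toFins (k ∷ ks) (k≤j VecAll.∷ ks≤j) = cong₂ _∷_ (Fin.toℕ-fromℕ< _) (map-toℕ-toFins ks ks≤j)

module DTWProperties {c ℓ} (G : OrderedGroup c ℓ) where
  open DTW G

  infixl 6 _-_
  _-_ : Carrier → Carrier → Carrier
  x - y = x + - y

  +-identityʳ : ∀ x → x + 0# ≡ x
  +-identityʳ x = trans (+-comm x 0#) (+-identityˡ x)

  -‿inverseʳ : ∀ x → x - x ≡ 0#
  -‿inverseʳ x = trans (+-comm x (- x)) (-‿inverseˡ x)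

  -0#≡0# : - 0# ≡ 0#
  -0#≡0# = trans (sym (+-identityˡ (- 0#))) (-‿inverseʳ 0#)

  +-monoʳ-≤ : ∀ {x y} z → x ≤ y → z + x ≤ z + y
  +-monoʳ-≤ {x} {y} z x≤y = subst₂ _≤_ (+-comm x z) (+-comm y z) (+-monoˡ-≤ z x≤y)

  x≤y+x : ∀ {x y} → 0# ≤ y → x ≤ y + x
  x≤y+x {x} {y} 0≤y = subst (_≤ y + x) (+-identityˡ x) (+-monoˡ-≤ x 0≤y)

  Abs-nonneg : ∀ {x e} → Abs x e → 0# ≤ e
  Abs-nonneg (abs-pos 0≤x) = 0≤x
  Abs-nonneg {x} (abs-neg x≤0) =
    subst₂ _≤_ (-‿inverseʳ x) (+-identityˡ (- x)) (+-monoˡ-≤ (- x) x≤0)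

  Abs-functional : ∀ {x e e′} → Abs x e → Abs x e′ → e ≡ e′
  Abs-functional (abs-pos _)   (abs-pos _)   = refl
  Abs-functional (abs-neg _)   (abs-neg _)   = refl
  Abs-functional (abs-pos 0≤x) (abs-neg x≤0) with ≤-antisym x≤0 0≤x
  ... | refl = sym -0#≡0#
  Abs-functional (abs-neg x≤0) (abs-pos 0≤x) with ≤-antisym x≤0 0≤x
  ... | refl = -0#≡0#

  ∣_∣ : Carrier → Carrier
  ∣ x ∣ with ≤-total 0# x
  ... | inj₁ _ = x
  ... | inj₂ _ = - x

  Abs-∣∣ : ∀ x → Abs x ∣ x ∣
  Abs-∣∣ x with ≤-total 0# x
  ... | inj₁ 0≤x = abs-pos 0≤x
  ... | inj₂ x≤0 = abs-neg x≤0

  Least : (Carrier → Set (c ⊔ ℓ)) → Set (c ⊔ ℓ)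
  Least P = ∃ λ m → P m × (∀ v → P v → m ≤ v)

  least-⊎ : ∀ {P Q} → Least P → Least Q → Least (λ v → P v ⊎ Q v)
  least-⊎ (m , Pm , m≤P) (m′ , Qm′ , m′≤Q) with ≤-total m m′
  ... | inj₁ m≤m′ = m , inj₁ Pm ,
    λ { v (inj₁ Pv) → m≤P v Pv ; v (inj₂ Qv) → ≤-trans m≤m′ (m′≤Q v Qv) }
  ... | inj₂ m′≤m = m′ , inj₂ Qm′ ,
    λ { v (inj₁ Pv) → ≤-trans m′≤m (m≤P v Pv) ; v (inj₂ Qv) → m′≤Q v Qv }

  -- Warp a x b y v: v is the cost of a warping path of a ∷ x and b ∷ y
  -- starting at the cell (a , b); left advances in a ∷ x, right in b ∷ y.
  data Warp : Carrier → List Carrier → Carrier → List Carrier → Carrier → Set (c ⊔ ℓ) where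
    end   : ∀ {a b e} → Abs (a - b) e → Warp a [] b [] e
    diag  : ∀ {a a′ x b b′ y e v} → Abs (a - b) e → Warp a′ x b′ y v →
            Warp a (a′ ∷ x) b (b′ ∷ y) (e + v)
    left  : ∀ {a a′ x b y e v} → Abs (a - b) e → Warp a′ x b y v → Warp a (a′ ∷ x) b y (e + v)
    right : ∀ {a x b b′ y e v} → Abs (a - b) e → Warp a x b′ y v → Warp a x b (b′ ∷ y) (e + v)

  Warp⇒Admissible : ∀ {a x b y v} → Warp a x b y v → Admissible (a ∷ x) (b ∷ y) v
  Warp⇒Admissible (end {e = e} ab) =
    _ , _ , (0 ∷ [] , refl) , (0 ∷ [] , refl) , refl , subst (L1 _ _) (+-identityʳ e) (l1-∷ ab l1-[])
  Warp⇒Admissible (diag ab w) with Warp⇒Admissible w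
  ... | _ , _ , (rs , refl) , (rs′ , refl) , len , l1 =
    _ , _ , (0 ∷ rs , refl) , (0 ∷ rs′ , refl) , cong suc len , l1-∷ ab l1
  Warp⇒Admissible (left ab w) with Warp⇒Admissible w
  ... | _ , _ , (rs , refl) , (r′ ∷ rs′ , refl) , len , l1 =
    _ , _ , (0 ∷ rs , refl) , (suc r′ ∷ rs′ , refl) , cong suc len , l1-∷ ab l1
  Warp⇒Admissible (right ab w) with Warp⇒Admissible w
  ... | _ , _ , (r ∷ rs , refl) , (rs′ , refl) , len , l1 =
    _ , _ , (suc r ∷ rs , refl) , (0 ∷ rs′ , refl) , cong suc len , l1-∷ ab l1

  -- A pair of cells repeated on both sides is dropped, which can only
  -- lower the cost since its contribution is nonnegative.
  L1-expand⇒Warp : ∀ a x r rs b y r′ rs′ {d} →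
    L1 (replicate (suc r) a ++ expand x rs) (replicate (suc r′) b ++ expand y rs′) d →
    ∃ λ v → Warp a x b y v × v ≤ d
  L1-expand⇒Warp a x (suc r) rs b y (suc r′) rs′ (l1-∷ ab l1)
    with L1-expand⇒Warp a x r rs b y r′ rs′ l1
  ... | v , w , v≤d = v , w , ≤-trans v≤d (x≤y+x (Abs-nonneg ab))
  L1-expand⇒Warp a (a′ ∷ x) zero (r ∷ rs) b y (suc r′) rs′ (l1-∷ ab l1)
    with L1-expand⇒Warp a′ x r rs b y r′ rs′ l1
  ... | v , w , v≤d = _ , left ab w , +-monoʳ-≤ _ v≤d
  L1-expand⇒Warp a x (suc r) rs b (b′ ∷ y) zero (r′ ∷ rs′) (l1-∷ ab l1)
    with L1-expand⇒Warp a x r rs b′ y r′ rs′ l1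
  ... | v , w , v≤d = _ , right ab w , +-monoʳ-≤ _ v≤d
  L1-expand⇒Warp a (a′ ∷ x) zero (r ∷ rs) b (b′ ∷ y) zero (r′ ∷ rs′) (l1-∷ ab l1)
    with L1-expand⇒Warp a′ x r rs b′ y r′ rs′ l1
  ... | v , w , v≤d = _ , diag ab w , +-monoʳ-≤ _ v≤d
  L1-expand⇒Warp a [] zero [] b [] zero [] (l1-∷ {e = e} ab l1-[]) =
    e , end ab , subst (e ≤_) (sym (+-identityʳ e)) ≤-refl
  L1-expand⇒Warp a [] zero [] b y (suc r′) rs′ (l1-∷ ab ())
  L1-expand⇒Warp a x (suc r) rs b [] zero [] (l1-∷ ab ())
  L1-expand⇒Warp a [] zero [] b (b′ ∷ y) zero (r′ ∷ rs′) (l1-∷ ab ())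
  L1-expand⇒Warp a (a′ ∷ x) zero (r ∷ rs) b [] zero [] (l1-∷ ab ())

  Admissible⇒Warp≤ : ∀ {a x b y d} → Admissible (a ∷ x) (b ∷ y) d → ∃ λ v → Warp a x b y v × v ≤ d
  Admissible⇒Warp≤ {a} {x} {b} {y} (_ , _ , (r ∷ rs , refl) , (r′ ∷ rs′ , refl) , _ , l1) =
    L1-expand⇒Warp a x r rs b y r′ rs′ l1

  least-step : ∀ {a b} {Next W : Carrier → Set (c ⊔ ℓ)} → Least Next →
    (∀ {e w} → Abs (a - b) e → Next w → W (e + w)) →
    (∀ {v} → W v → ∃₂ λ e w → Abs (a - b) e × Next w × v ≡ e + w) →
    Least W
  least-step {a} {b} {W = W} (m , Nm , m≤N) step first = ∣ a - b ∣ + m , step (Abs-∣∣ _) Nm , minimal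
    where
      minimal : ∀ v → W v → ∣ a - b ∣ + m ≤ v
      minimal v Wv with first Wv
      ... | e , w , ab , Nw , refl =
        subst (λ e′ → ∣ a - b ∣ + m ≤ e′ + w) (Abs-functional (Abs-∣∣ _) ab) (+-monoʳ-≤ _ (m≤N w Nw))

  cheapestWarp : ∀ a x b y → Least (Warp a x b y)
  cheapestWarp a [] b [] =
    ∣ a - b ∣ , end (Abs-∣∣ _) ,
    λ { _ (end ab) → subst (∣ a - b ∣ ≤_) (Abs-functional (Abs-∣∣ _) ab) ≤-refl }
  cheapestWarp a (a′ ∷ x) b [] =
    least-step (cheapestWarp a′ x b []) left λ { (left ab w) → _ , _ , ab , w , refl }
  cheapestWarp a [] b (b′ ∷ y) =
    least-step (cheapestWarp a [] b′ y) right λ { (right ab w) → _ , _ , ab , w , refl }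
  cheapestWarp a (a′ ∷ x) b (b′ ∷ y) =
    least-step
      (least-⊎ (cheapestWarp a′ x b′ y)
        (least-⊎ (cheapestWarp a′ x b (b′ ∷ y)) (cheapestWarp a (a′ ∷ x) b′ y)))
      (λ ab → [ diag ab , [ left ab , right ab ] ])
      λ { (diag ab w)  → _ , _ , ab , inj₁ w , refl
        ; (left ab w)  → _ , _ , ab , inj₂ (inj₁ w) , refl
        ; (right ab w) → _ , _ , ab , inj₂ (inj₂ w) , refl
        }

  dtw-∷ : ∀ a x b y → ∃ λ m → Warp a x b y m × IsDTW (a ∷ x) (b ∷ y) m
  dtw-∷ a x b y with cheapestWarp a x b y
  ... | m , w , m≤W = m , w , Warp⇒Admissible w , λ d adm →
    let v , w′ , v≤d = Admissible⇒Warp≤ adm in ≤-trans (m≤W v w′) v≤d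

  dtw-[] : IsDTW [] [] 0#
  dtw-[] = ([] , [] , ([] , refl) , ([] , refl) , refl , l1-[]) ,
           λ { _ (_ , _ , ([] , refl) , ([] , refl) , _ , l1-[]) → ≤-refl }

  ¬Admissible-[]-∷ : ∀ {b y} → ¬ (∃ λ d → Admissible [] (b ∷ y) d)
  ¬Admissible-[]-∷ (_ , _ , _ , ([] , refl) , (_ ∷ _ , refl) , _ , ())

  ¬Admissible-∷-[] : ∀ {a x} → ¬ (∃ λ d → Admissible (a ∷ x) [] d)
  ¬Admissible-∷-[] (_ , _ , _ , (_ ∷ _ , refl) , ([] , refl) , _ , ())

  x+[y+z]≡y+[x+z] : ∀ x y z → x + (y + z) ≡ y + (x + z)
  x+[y+z]≡y+[x+z] x y z = trans (sym (+-assoc x y z)) (trans (cong (_+ z) (+-comm x y)) (+-assoc y x z))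

  infixr 7 _·_
  _·_ : ℕ → Carrier → Carrier
  zero  · x = 0#
  suc k · x = x + k · x

  linComb : (T : List Carrier) → Vec ℕ (length T) → Carrier
  linComb []      []       = 0#
  linComb (t ∷ T) (k ∷ ks) = k · t + linComb T ks

  record Combination (T : List Carrier) (j : ℕ) (v : Carrier) : Set c where
    constructor combination
    field
      coefficients : Vec ℕ (length T)
      bounded      : VecAll.All (ℕ._≤ j) coefficients
      value        : linComb T coefficients ≡ v

  combination-0# : ∀ T {j} → Combination T j 0#
  combination-0# []      = combination [] VecAll.[] refl
  combination-0# (t ∷ T) with combination-0# T
  ... | combination ks ks≤j eq = combination (0 ∷ ks) (z≤n VecAll.∷ ks≤j) (trans (+-identityˡ _) eq)

  combination-+ : ∀ {T j e v} → e ∈ T → Combination T j v → Combination T (suc j) (e + v)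
  combination-+ {t ∷ T} (here refl) (combination (k ∷ ks) (k≤j VecAll.∷ ks≤j) refl) =
    combination (suc k ∷ ks) (s≤s k≤j VecAll.∷ VecAll.map ℕ.m≤n⇒m≤1+n ks≤j)
      (+-assoc t (k · t) (linComb T ks))
  combination-+ {t ∷ T} {e = e} (there e∈T) (combination (k ∷ ks) (k≤j VecAll.∷ ks≤j) refl)
    with combination-+ e∈T (combination ks ks≤j refl)
  ... | combination ks′ ks′≤j eq =
    combination (k ∷ ks′) (ℕ.m≤n⇒m≤1+n k≤j VecAll.∷ ks′≤j)
      (trans (cong (k · t +_) eq) (x+[y+z]≡y+[x+z] (k · t) e (linComb T ks)))

  combination-mono : ∀ {T j j′ v} → j ℕ.≤ j′ → Combination T j v → Combination T j′ v
  combination-mono j≤j′ (combination ks ks≤j eq) =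
    combination ks (VecAll.map (λ k≤j → ℕ.≤-trans k≤j j≤j′) ks≤j) eq

  absDiffs : List Carrier → List Carrier → List Carrier
  absDiffs = cartesianProductWith (λ a b → ∣ a - b ∣)

  Abs∈absDiffs : ∀ {Γ Δ a b e} → a ∈ Γ → b ∈ Δ → Abs (a - b) e → e ∈ absDiffs Γ Δ
  Abs∈absDiffs {a = a} {b} a∈Γ b∈Δ ab =
    subst (_∈ _) (Abs-functional (Abs-∣∣ (a - b)) ab) (∈-cartesianProductWith⁺ (λ a b → ∣ a - b ∣) a∈Γ b∈Δ)

  Warp⇒Combination : ∀ {Γ Δ a x b y v} → Warp a x b y v → All (_∈ Γ) (a ∷ x) → All (_∈ Δ) (b ∷ y) →
    Combination (absDiffs Γ Δ) (suc (length x ℕ.+ length y)) v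
  Warp⇒Combination (end {e = e} ab) (a∈Γ ∷ []) (b∈Δ ∷ []) =
    subst (Combination _ 1) (+-identityʳ e) (combination-+ (Abs∈absDiffs a∈Γ b∈Δ ab) (combination-0# _))
  Warp⇒Combination {x = _ ∷ x} {y = _ ∷ y} (diag ab w) (a∈Γ ∷ x∈Γ) (b∈Δ ∷ y∈Δ) =
    combination-mono (s≤s (s≤s (ℕ.+-monoʳ-≤ (length x) (ℕ.n≤1+n (length y)))))
      (combination-+ (Abs∈absDiffs a∈Γ b∈Δ ab) (Warp⇒Combination w x∈Γ y∈Δ))
  Warp⇒Combination (left ab w) (a∈Γ ∷ x∈Γ) (b∈Δ ∷ y∈Δ) =
    combination-+ (Abs∈absDiffs a∈Γ b∈Δ ab) (Warp⇒Combination w x∈Γ (b∈Δ ∷ y∈Δ))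
  Warp⇒Combination {x = x} {y = _ ∷ y} (right ab w) (a∈Γ ∷ x∈Γ) (b∈Δ ∷ y∈Δ) =
    combination-mono (ℕ.≤-reflexive (sym (cong suc (ℕ.+-suc (length x) (length y)))))
      (combination-+ (Abs∈absDiffs a∈Γ b∈Δ ab) (Warp⇒Combination w (a∈Γ ∷ x∈Γ) y∈Δ))

  module Queries (Γ Σ′ : List Carrier) (n L : ℕ) where

    T : List Carrier
    T = absDiffs Γ Σ′

    J : ℕ
    J = n ℕ.+ L

    Code : Set
    Code = Fin (suc (suc J ℕ.^ length T))

    open Inverse (Vec[Fin]↔Fin[^] (suc J) (length T)) using (to; from; strictlyInverseʳ)

    -- zero encodes the answer ∞; suc encodes a coefficient vector over T.
    decode : Code → Maybe Carrier
    decode zero    = nothing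
    decode (suc i) = just (linComb T (Vec.map toℕ (from i)))

    Combination⇒code : ∀ {v} → Combination T J v → ∃ λ code → decode code ≡ just v
    Combination⇒code (combination ks ks≤J refl) =
      suc (to (toFins ks ks≤J)) , cong (just ∘ linComb T) (begin
      Vec.map toℕ (from (to (toFins ks ks≤J))) ≡⟨ cong (Vec.map toℕ) (strictlyInverseʳ _) ⟩
      Vec.map toℕ (toFins ks ks≤J)             ≡⟨ map-toℕ-toFins ks ks≤J ⟩
      ks                                        ∎)
      where open ≡-Reasoning

    answerCode : ∀ {s q} → All (_∈ Γ) s → length s ℕ.≤ n → All (_∈ Σ′) q → length q ℕ.≤ L →
      ∃ λ code → Answer s q (decode code)
    answerCode {[]} {[]} _ _ _ _ with Combination⇒code (combination-0# T)
    ... | code , eq = code , subst (Answer [] []) (sym eq) dtw-[]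
    answerCode {[]}    {_ ∷ _} _ _ _ _ = zero , ¬Admissible-[]-∷
    answerCode {_ ∷ _} {[]}    _ _ _ _ = zero , ¬Admissible-∷-[]
    answerCode {a ∷ x} {b ∷ y} s∈Γ s≤n q∈Σ′ q≤L with dtw-∷ a x b y
    ... | m , w , isDTW with Combination⇒code (combination-mono cells≤J (Warp⇒Combination w s∈Γ q∈Σ′))
      where
        cells≤J : suc (length x ℕ.+ length y) ℕ.≤ J
        cells≤J = ℕ.≤-trans (s≤s (ℕ.+-monoʳ-≤ (length x) (ℕ.n≤1+n (length y)))) (ℕ.+-mono-≤ s≤n q≤L)
    ... | code , eq = code , subst (Answer (a ∷ x) (b ∷ y)) (sym eq) isDTW

    transcript : ∀ A k {s} → All (_∈ Γ) s → length s ℕ.≤ n → Recovers Σ′ L A s k → Vec Code k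
    transcript (output o) k _ _ _ = Vec.replicate k zero
    transcript (ask q f) zero _ _ (lift ())
    transcript (ask q f) (suc k) s∈Γ s≤n (q∈Σ′ , lift q≤L , recovers) with answerCode s∈Γ s≤n q∈Σ′ q≤L
    ... | code , answer = code ∷ transcript (f (decode code)) k s∈Γ s≤n (recovers _ answer)

    transcript-injective : ∀ A k {s s′} (s∈Γ : All (_∈ Γ) s) (s≤n : length s ℕ.≤ n)
      (s′∈Γ : All (_∈ Γ) s′) (s′≤n : length s′ ℕ.≤ n) R R′ →
      transcript A k s∈Γ s≤n R ≡ transcript A k s′∈Γ s′≤n R′ → s ≡ s′
    transcript-injective (output o) k _ _ _ _ (lift o≡s) (lift o≡s′) _ = trans (sym o≡s) o≡s′
    transcript-injective (ask q f) zero _ _ _ _ (lift ()) _ _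
    transcript-injective (ask q f) (suc k) s∈Γ s≤n s′∈Γ s′≤n
      (q∈Σ′ , lift q≤L , R) (q∈Σ′₂ , lift q≤L₂ , R′) eq
      with answerCode s∈Γ s≤n q∈Σ′ q≤L | answerCode s′∈Γ s′≤n q∈Σ′₂ q≤L₂
    ... | code , _ | _ , _ with Vec.∷-injective eq
    ... | refl , eq′ = transcript-injective (f (decode code)) k s∈Γ s≤n s′∈Γ s′≤n _ _ eq′

  binary : List Carrier
  binary = 0# ∷ 1# ∷ []

  Bit⇒∈binary : ∀ {a} → Bit a → a ∈ binary
  Bit⇒∈binary (inj₁ refl) = here refl
  Bit⇒∈binary (inj₂ refl) = there (here refl)

  bit : Fin 2 → Carrier
  bit zero    = 0#
  bit (suc _) = 1#

  bit-Bit : ∀ i → Bit (bit i)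
  bit-Bit zero    = inj₁ refl
  bit-Bit (suc _) = inj₂ refl

  bit-injective : Injective _≡_ _≡_ bit
  bit-injective {zero}     {zero}     _   = refl
  bit-injective {suc zero} {suc zero} _   = refl
  bit-injective {zero}     {suc zero} 0≡1 = ⊥-elim (0≢1 0≡1)
  bit-injective {suc zero} {zero}     1≡0 = ⊥-elim (0≢1 (sym 1≡0))

  word : ∀ {n} → Vec (Fin 2) n → List Carrier
  word = List.map bit ∘ Vec.toList

  word-Bit : ∀ {n} (v : Vec (Fin 2) n) → All Bit (word v)
  word-Bit v = map⁺ (All.universal bit-Bit (Vec.toList v))

  length-word : ∀ {n} (v : Vec (Fin 2) n) → length (word v) ≡ n
  length-word v = trans (List.length-map bit (Vec.toList v)) (Vec.length-toList v)

  word-injective : ∀ {n} → Injective _≡_ _≡_ (word {n})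
  word-injective {x = u} {v} eq =
    trans (sym (cast-is-id refl u)) (Vec.toList-injective refl u v (List.map-injective bit-injective eq))

  recovery⇒2^n≤#transcripts : ∀ Σ′ n L A k →
    (∀ s → All Bit s → length s ℕ.≤ n → Recovers Σ′ L A s k) →
    2 ℕ.^ n ℕ.≤ suc (suc (n ℕ.+ L) ℕ.^ length (absDiffs binary Σ′)) ℕ.^ k
  recovery⇒2^n≤#transcripts Σ′ n L A k recovers = Fin.injective⇒≤ (Injection.injective inputs↣transcripts)
    where
      open Queries binary Σ′ n L using (Code; transcript; transcript-injective)

      word≤n : (v : Vec (Fin 2) n) → length (word v) ℕ.≤ n
      word≤n v = ℕ.≤-reflexive (length-word v)

      transcriptOf : Vec (Fin 2) n → Vec Code k
      transcriptOf v = transcript A k (All.map Bit⇒∈binary (word-Bit v)) (word≤n v)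
                                      (recovers (word v) (word-Bit v) (word≤n v))

      inputs↣transcripts : Fin (2 ℕ.^ n) ↣ Fin (suc (suc (n ℕ.+ L) ℕ.^ length (absDiffs binary Σ′)) ℕ.^ k)
      inputs↣transcripts =
        ↣-trans (↔⇒↣ (↔-sym (Vec[Fin]↔Fin[^] 2 n)))
          (↣-trans (mk↣ {to = transcriptOf} (word-injective ∘ transcript-injective A k _ _ _ _ _ _))
            (↔⇒↣ (Vec[Fin]↔Fin[^] _ k)))

open Arithmetic
open import Data.Nat using (_+_; _≤_; _*_)
open import Data.Nat.Logarithm using (⌊log₂_⌋)

mainTheorem12 : ∀ {c ℓ} (G : OrderedGroup c ℓ) →
    (Σ' : List (OrderedGroup.Carrier G)) →
    OrderedGroup.0# G ∈ Σ' → OrderedGroup.1# G ∈ Σ' →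
    (C : ℕ) →
    ∃ λ (a : ℕ) → ∃ λ (N : ℕ) →
      ∀ (n : ℕ) → N ≤ n →
      ∀ (A : DTW.Algorithm G) (k : ℕ) →
      (∀ (s : List (OrderedGroup.Carrier G)) → All (DTW.Bit G) s →
         length s ≤ n → DTW.Recovers G Σ' (C * n) A s k) →
      n ≤ a * k * ⌊log₂ n ⌋
mainTheorem12 G Σ' _ _ C = 4 * suc t , 2 + C , λ n 2+C≤n A k recovers →
  exponential≤polynomial⇒n≤k*⌊log₂n⌋ C t k 2+C≤n (recovery⇒2^n≤#transcripts Σ' n (C * n) A k recovers)
  where
    open DTWProperties G using (absDiffs; binary; recovery⇒2^n≤#transcripts)
    t = length (absDiffs binary Σ')
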